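{- Let $k\geq 4$ be an even integer. There exists a connected graph $G$ with $\gamma_t^{\mathrm{ID}}(G)=k$ and $\gamma_S^{\mathrm{ID}}(G)=2^k-2$.
   Context: All graphs are finite, simple and undirected. $N[v]$ is the closed neighbourhood of $v$; for $C\subseteq V(G)$, $I(v)=N[v]\cap C$. A total dominating identifying code is a set $C$ with $I(u)\neq I(v)$ for all distinct vertices $u,v$ and such that every vertex has a neighbour in $C$; $\gamma_t^{\mathrm{ID}}(G)$ is its minimum size. A self-identifying code is a set $C\subseteq V(G)$ such that $I(u)\setminus I(v)\neq\emptyset$ for all distinct vertices $u,v$; $\gamma_S^{\mathrm{ID}}(G)$ is its minimum size. -}

module Defs where

open import Data.Nat using (ℕ; _≤_)
open import Data.Fin using (Fin)
open import Data.Fin.Subset using (Subset; _∈_; _∉_; ∣_∣)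
open import Data.Product using (Σ; ∃; _×_)
open import Data.Sum using (_⊎_)
open import Relation.Nullary using (¬_)
open import Relation.Binary.PropositionalEquality using (_≡_)
open import Relation.Binary.Construct.Closure.ReflexiveTransitive using (Star)
open import Level using (0ℓ)

record Graph : Set₁ where
  field
    n      : ℕ
    Adj    : Fin n → Fin n → Set
    sym    : ∀ {u v} → Adj u v → Adj v u
    irrefl : ∀ {v} → ¬ Adj v v

module _ (G : Graph) where
  open Graph G

  Connected : Set
  Connected = ∀ (u v : Fin n) → Star Adj u v

  InN : Fin n → Fin n → Set
  InN v w = (w ≡ v) ⊎ Adj v w

  InI : Subset n → Fin n → Fin n → Set
  InI C v w = (w ∈ C) × InN v w

  Separates : Subset n → Fin n → Fin n → Set
  Separates C u v = ¬ (∀ w → (InI C u w → InI C v w) × (InI C v w → InI C u w))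

  IsTotalDomIdCode : Subset n → Set
  IsTotalDomIdCode C =
    (∀ u v → ¬ (u ≡ v) → Separates C u v) ×
    (∀ v → ∃ λ w → (w ∈ C) × Adj v w)

  IsSelfIdCode : Subset n → Set
  IsSelfIdCode C =
    ∀ u v → ¬ (u ≡ v) → ∃ λ w → InI C u w × ¬ InI C v w

  MinSizeIs : (Subset n → Set) → ℕ → Set
  MinSizeIs P k =
    (∃ λ C → P C × ∣ C ∣ ≡ k) × (∀ C → P C → k ≤ ∣ C ∣)

  γtID≡ : ℕ → Set
  γtID≡ = MinSizeIs IsTotalDomIdCode

  γSID≡ : ℕ → Set
  γSID≡ = MinSizeIs IsSelfIdCode

{-# OPTIONS --safe #-}
module Submission where

-- Take k code vertices paired by a fixed-point-free involution p, and one further vertex for every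
-- subset S of them with 1 ≤ |S| ≤ k − 2.  Code vertex i is adjacent to every code vertex except
-- p i and to every S containing i; two subset vertices are adjacent when together they cover all
-- code vertices or are the singletons {j} and {p j}.  The traces of the vertices on the code are
-- then ∁{p i} and S: every nonempty proper subset exactly once, so the code vertices form a total
-- dominating identifying code, and no identifying code C has fewer than k vertices because the
-- 2^k − 2 vertices need distinct traces, 2^k − 2 ≤ 2^|C|.  No closed neighbourhood contains
-- another, so the whole vertex set is self-identifying; conversely each vertex x is the only
-- vertex of N[u] ∖ N[v] for some u ≠ v, so every self-identifying code contains x.

open import Defs
open import Data.Bool using (Bool)
import Data.Bool.Properties as Bool
open import Data.Nat using (ℕ; zero; suc; _+_; _*_; _^_; _∸_; _≤_; z≤n; s≤s; s≤s⁻¹)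
open import Data.Nat.Properties
  using (+-identityʳ; ≤-trans; ≤-reflexive; ≮⇒≥; n≤1+n; ^-monoʳ-≤; +-cancelˡ-≤; +-monoˡ-≤; m+n∸n≡m;
         module ≤-Reasoning)
open import Data.Nat.Divisibility using (_∣_; divides)
open import Data.Nat.Tactic.RingSolver using (solve-∀)
open import Data.Fin using (Fin; zero; suc; splitAt; join; _↑ˡ_; _↑ʳ_)
open import Data.Fin.Properties
  using (suc-injective; _≟_; any?; all?; injective⇒≤; join-splitAt; splitAt-join; splitAt-↑ˡ; splitAt-↑ʳ)
open import Data.Fin.Subset
  using (Subset; inside; outside; _∈_; _∉_; _⊆_; _∪_; ∁; ⁅_⁆; Nonempty; ∣_∣; ⊤; ⊥)
open import Data.Fin.Subset.Properties
  using (_∈?_; drop-there; ⊆-antisym; ⊆⊤; ∈⊤; ∣⊤∣≡n; ∣⊥∣≡0; x∈⁅x⁆; x∈⁅y⁆⇒x≡y; x≢y⇒x∉⁅y⁆; x∉⁅y⁆⇒x≢y;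
         x∈∁p⇒x∉p; x∉∁p⇒x∈p; x∉p⇒x∈∁p; x∈p∪q⁺; x∈p∪q⁻)
open import Data.Vec using ([]; _∷_; _++_; here; there)
open import Data.Vec.Properties
  using (≡-dec; ∷-injective; ∷-injectiveʳ; lookup⇒[]=; lookup-++ˡ; lookup-replicate)
open import Data.Product using (∃; ∃₂; _×_; _,_; proj₁; proj₂)
open import Data.Product.Function.NonDependent.Propositional using (_×-⇔_)
open import Data.Sum using (_⊎_; inj₁; inj₂; [_,_]′)
import Data.Sum as Sum
open import Data.Sum.Properties using (inj₂-injective) renaming (≡-dec to ⊎-≡-dec)
open import Data.Unit using (tt)
open import Function using (_∘_; _⇔_; mk⇔; Equivalence)
open import Function.Construct.Composition using (_⇔-∘_)
open import Function.Construct.Symmetry using (⇔-sym)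
open import Function.Definitions using (Injective)
open import Relation.Nullary using (¬_; contradiction; Dec; yes; no; does)
open import Relation.Nullary.Decidable using (dec-true; decidable-stable; _⊎-dec_; _×-dec_; ¬?)
open import Relation.Unary using (U)
open import Relation.Binary.PropositionalEquality
  using (_≡_; _≢_; refl; sym; trans; cong; cong₂; subst; subst₂; module ≡-Reasoning)
open import Relation.Binary.Construct.Closure.ReflexiveTransitive using (Star; ε; _◅_; _◅◅_; gmap)

open Equivalence using (to; from)

record Enumeration {k : ℕ} (P : Subset k → Set) : Set where
  field
    size             : ℕ
    decode           : Fin size → Subset k
    decode-injective : Injective _≡_ _≡_ decode
    decode-sound     : ∀ i → P (decode i)
    decode-complete  : ∀ S → P S → ∃ λ i → decode i ≡ S

open Enumeration

module _ {P : Subset 0 → Set} where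

  enumeration₀-yes : P [] → Enumeration P
  enumeration₀-yes p = record
    { size = 1 ; decode = λ _ → [] ; decode-injective = λ { {zero} {zero} _ → refl }
    ; decode-sound = λ _ → p ; decode-complete = λ { [] _ → zero , refl } }

  enumeration₀-no : ¬ P [] → Enumeration P
  enumeration₀-no ¬p = record
    { size = 0 ; decode = λ () ; decode-injective = λ { {()} }
    ; decode-sound = λ () ; decode-complete = λ { [] p → contradiction p ¬p } }

splitAt-injective : ∀ m {n} → Injective _≡_ _≡_ (splitAt m {n})
splitAt-injective m {n} {i} {j} eq = begin
  i                      ≡⟨ join-splitAt m n i ⟨
  join m n (splitAt m i) ≡⟨ cong (join m n) eq ⟩
  join m n (splitAt m j) ≡⟨ join-splitAt m n j ⟩
  j                      ∎
  where open ≡-Reasoning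

module _ {k} {P : Subset (suc k) → Set} where

  ∷-enumeration : Enumeration (λ S → P (inside ∷ S)) → Enumeration (λ S → P (outside ∷ S)) → Enumeration P
  ∷-enumeration I O = record
    { size = size I + size O
    ; decode = tag ∘ splitAt (size I)
    ; decode-injective = splitAt-injective (size I) ∘ tag-injective
    ; decode-sound = sound ∘ splitAt (size I)
    ; decode-complete = complete
    }
    where
    tag : Fin (size I) ⊎ Fin (size O) → Subset (suc k)
    tag = [ (inside ∷_) ∘ decode I , (outside ∷_) ∘ decode O ]′

    tag-injective : Injective _≡_ _≡_ tag
    tag-injective {inj₁ x} {inj₁ y} eq = cong inj₁ (decode-injective I (∷-injectiveʳ eq))
    tag-injective {inj₂ x} {inj₂ y} eq = cong inj₂ (decode-injective O (∷-injectiveʳ eq))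
    tag-injective {inj₁ x} {inj₂ y} ()
    tag-injective {inj₂ x} {inj₁ y} ()

    sound : ∀ i → P (tag i)
    sound (inj₁ x) = decode-sound I x
    sound (inj₂ y) = decode-sound O y

    complete : ∀ S → P S → ∃ λ i → tag (splitAt (size I) i) ≡ S
    complete (inside ∷ S) p with decode-complete I S p
    ... | x , refl = x ↑ˡ size O , cong tag (splitAt-↑ˡ (size I) x (size O))
    complete (outside ∷ S) p with decode-complete O S p
    ... | y , refl = size I ↑ʳ y , cong tag (splitAt-↑ʳ (size I) (size O) y)

mapᴱ : ∀ {k} {P Q : Subset k → Set} → (∀ {S} → P S ⇔ Q S) → Enumeration P → Enumeration Q
mapᴱ P⇔Q E = record
  { size = size E ; decode = decode E ; decode-injective = decode-injective E
  ; decode-sound = to P⇔Q ∘ decode-sound E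
  ; decode-complete = λ S → decode-complete E S ∘ from P⇔Q }

encode : ∀ {k} {P : Subset k → Set} (E : Enumeration P) (S : Subset k) → P S → Fin (size E)
encode E S p = proj₁ (decode-complete E S p)

decode-encode : ∀ {k} {P : Subset k → Set} (E : Enumeration P) S (p : P S) → decode E (encode E S p) ≡ S
decode-encode E S p = proj₂ (decode-complete E S p)

encode-injective : ∀ {k} (E : Enumeration {k} U) → Injective _≡_ _≡_ (λ S → encode E S tt)
encode-injective E {S} {T} eq = begin
  S                        ≡⟨ decode-encode E S tt ⟨
  decode E (encode E S tt) ≡⟨ cong (decode E) eq ⟩
  decode E (encode E T tt) ≡⟨ decode-encode E T tt ⟩
  T                        ∎
  where open ≡-Reasoning

module _ {k : ℕ} where

  Nonfull : Subset k → Set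
  Nonfull S = ∃ λ x → x ∉ S

  TwoOutside : Subset k → Set
  TwoOutside S = ∃₂ λ x y → x ≢ y × x ∉ S × y ∉ S

  Proper : Subset k → Set
  Proper S = Nonempty S × Nonfull S

  Medium : Subset k → Set
  Medium S = Nonempty S × TwoOutside S

module _ {k} {S : Subset k} where

  nonempty-inside∷ : Nonempty (inside ∷ S)
  nonempty-inside∷ = zero , here

  nonempty-outside∷ : Nonempty (outside ∷ S) ⇔ Nonempty S
  nonempty-outside∷ = mk⇔ (λ { (suc x , there x∈S) → x , x∈S }) (λ (x , x∈S) → suc x , there x∈S)

  nonfull-outside∷ : Nonfull (outside ∷ S)
  nonfull-outside∷ = zero , λ ()

  nonfull-inside∷ : Nonfull (inside ∷ S) ⇔ Nonfull S
  nonfull-inside∷ = mk⇔ to′ (λ (x , x∉S) → suc x , x∉S ∘ drop-there)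
    where
    to′ : Nonfull (inside ∷ S) → Nonfull S
    to′ (zero  , 0∉) = contradiction here 0∉
    to′ (suc x , x∉) = x , x∉ ∘ there

  twoOutside-inside∷ : TwoOutside (inside ∷ S) ⇔ TwoOutside S
  twoOutside-inside∷ = mk⇔ to′ from′
    where
    to′ : TwoOutside (inside ∷ S) → TwoOutside S
    to′ (zero  , _     , _ , 0∉ , _) = contradiction here 0∉
    to′ (suc x , zero  , _ , _ , 0∉) = contradiction here 0∉
    to′ (suc x , suc y , x≢y , x∉ , y∉) = x , y , x≢y ∘ cong suc , x∉ ∘ there , y∉ ∘ there
    from′ : TwoOutside S → TwoOutside (inside ∷ S)
    from′ (x , y , x≢y , x∉ , y∉) = suc x , suc y , x≢y ∘ suc-injective , x∉ ∘ drop-there , y∉ ∘ drop-there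

  twoOutside-outside∷ : TwoOutside (outside ∷ S) ⇔ Nonfull S
  twoOutside-outside∷ = mk⇔ to′ (λ (y , y∉) → zero , suc y , (λ ()) , (λ ()) , y∉ ∘ drop-there)
    where
    to′ : TwoOutside (outside ∷ S) → Nonfull S
    to′ (zero  , zero  , x≢y , _) = contradiction refl x≢y
    to′ (zero  , suc y , _ , _ , y∉) = y , y∉ ∘ there
    to′ (suc x , _     , _ , x∉ , _) = x , x∉ ∘ there

inhabited⇔U : ∀ {A : Set} → A → A ⇔ U tt
inhabited⇔U a = mk⇔ (λ _ → tt) (λ _ → a)

drop-×ˡ : ∀ {A B C : Set} → A → B ⇔ C → (A × B) ⇔ C
drop-×ˡ a B⇔C = mk⇔ (to B⇔C ∘ proj₂) (λ c → a , from B⇔C c)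

drop-×ʳ : ∀ {A B C : Set} → B → A ⇔ C → (A × B) ⇔ C
drop-×ʳ b A⇔C = mk⇔ (to A⇔C ∘ proj₁) (λ c → from A⇔C c , b)

all : ∀ k → Enumeration {k} U
all zero    = enumeration₀-yes tt
all (suc k) = ∷-enumeration (all k) (all k)

nonempty : ∀ k → Enumeration {k} Nonempty
nonempty zero    = enumeration₀-no λ ()
nonempty (suc k) = ∷-enumeration (mapᴱ (⇔-sym (inhabited⇔U nonempty-inside∷)) (all k))
                                 (mapᴱ (⇔-sym nonempty-outside∷) (nonempty k))

nonfull : ∀ k → Enumeration {k} Nonfull
nonfull zero    = enumeration₀-no λ ()
nonfull (suc k) = ∷-enumeration (mapᴱ (⇔-sym nonfull-inside∷) (nonfull k))
                                (mapᴱ (⇔-sym (inhabited⇔U nonfull-outside∷)) (all k))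

proper : ∀ k → Enumeration {k} Proper
proper zero    = enumeration₀-no λ ()
proper (suc k) = ∷-enumeration (mapᴱ (⇔-sym (drop-×ˡ nonempty-inside∷ nonfull-inside∷)) (nonfull k))
                               (mapᴱ (⇔-sym (drop-×ʳ nonfull-outside∷ nonempty-outside∷)) (nonempty k))

twoOutside : ∀ k → Enumeration {k} TwoOutside
twoOutside zero    = enumeration₀-no λ ()
twoOutside (suc k) = ∷-enumeration (mapᴱ (⇔-sym twoOutside-inside∷) (twoOutside k))
                                   (mapᴱ (⇔-sym twoOutside-outside∷) (nonfull k))

medium : ∀ k → Enumeration {k} Medium
medium zero    = enumeration₀-no λ ()
medium (suc k) = ∷-enumeration (mapᴱ (⇔-sym (drop-×ˡ nonempty-inside∷ twoOutside-inside∷)) (twoOutside k))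
                               (mapᴱ (⇔-sym (nonempty-outside∷ ×-⇔ twoOutside-outside∷)) (proper k))

size-all : ∀ k → size (all k) ≡ 2 ^ k
size-all zero    = refl
size-all (suc k) = cong₂ _+_ (size-all k) (trans (size-all k) (sym (+-identityʳ (2 ^ k))))

size-nonempty : ∀ k → size (nonempty k) + 1 ≡ size (all k)
size-nonempty zero    = refl
size-nonempty (suc k) =
  trans (rearrange (size (all k)) (size (nonempty k))) (cong (size (all k) +_) (size-nonempty k))
  where
  rearrange : ∀ a b → a + b + 1 ≡ a + (b + 1)
  rearrange = solve-∀

size-nonfull : ∀ k → size (nonfull k) + 1 ≡ size (all k)
size-nonfull zero    = refl
size-nonfull (suc k) =
  trans (rearrange (size (nonfull k)) (size (all k))) (cong (_+ size (all k)) (size-nonfull k))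
  where
  rearrange : ∀ a b → a + b + 1 ≡ a + 1 + b
  rearrange = solve-∀

size-proper : ∀ k → size (proper (suc k)) + 2 ≡ size (all (suc k))
size-proper k =
  trans (rearrange (size (nonfull k)) (size (nonempty k))) (cong₂ _+_ (size-nonfull k) (size-nonempty k))
  where
  rearrange : ∀ a b → a + b + 2 ≡ (a + 1) + (b + 1)
  rearrange = solve-∀

size-twoOutside : ∀ k → size (twoOutside k) + 1 + k ≡ size (all k)
size-twoOutside zero    = refl
size-twoOutside (suc k) =
  trans (rearrange (size (twoOutside k)) (size (nonfull k)) k)
        (cong₂ _+_ (size-twoOutside k) (size-nonfull k))
  where
  rearrange : ∀ a b k → a + b + 1 + suc k ≡ (a + 1 + k) + (b + 1)
  rearrange = solve-∀

size-medium : ∀ k → 2 ≤ k → k + size (medium k) + 2 ≡ 2 ^ k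
size-medium (suc (suc k)) (s≤s (s≤s z≤n)) = begin
  2 + k + (size (twoOutside (suc k)) + size (proper (suc k))) + 2
    ≡⟨ rearrange (size (twoOutside (suc k))) (size (proper (suc k))) k ⟩
  (size (twoOutside (suc k)) + 1 + suc k) + (size (proper (suc k)) + 2)
    ≡⟨ cong₂ _+_ (size-twoOutside (suc k)) (size-proper k) ⟩
  size (all (2 + k))
    ≡⟨ size-all (2 + k) ⟩
  2 ^ (2 + k) ∎
  where
  open ≡-Reasoning
  rearrange : ∀ a b k → 2 + k + (a + b) + 2 ≡ (a + 1 + suc k) + (b + 2)
  rearrange = solve-∀

restrict : ∀ {n} (C : Subset n) → (Fin n → Bool) → Subset ∣ C ∣
restrict []            f = []
restrict (inside  ∷ C) f = f zero ∷ restrict C (f ∘ suc)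
restrict (outside ∷ C) f = restrict C (f ∘ suc)

restrict-injective : ∀ {n} (C : Subset n) {f g : Fin n → Bool} → restrict C f ≡ restrict C g →
                     ∀ {x} → x ∈ C → f x ≡ g x
restrict-injective (inside  ∷ C) eq here        = proj₁ (∷-injective eq)
restrict-injective (inside  ∷ C) eq (there x∈C) = restrict-injective C (∷-injectiveʳ eq) x∈C
restrict-injective (outside ∷ C) eq (there x∈C) = restrict-injective C eq x∈C

does-transfer : ∀ {A B : Set} (a? : Dec A) (b? : Dec B) → does a? ≡ does b? → A → B
does-transfer a? (yes b) _  _ = b
does-transfer a? (no _)  eq a with () ← trans (sym (dec-true a? a)) eq

module _ {V : Set} (N : V → V → Set) where

  Private : V → V → V → Set
  Private u v w = N u w × ¬ N v w

  Pinned : V → Set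
  Pinned x = ∃₂ λ u v → u ≢ v × (∀ w → Private u v w → w ≡ x)

module _ (G : Graph) where
  open Graph G using (n)

  separating-code-size : (∀ v w → Dec (InN G v w)) → (C : Subset n) →
                         (∀ u v → u ≢ v → Separates G C u v) → n ≤ 2 ^ ∣ C ∣
  separating-code-size InN? C separates =
    subst (n ≤_) (size-all ∣ C ∣) (injective⇒≤ {f = index ∘ trace} trace-injective)
    where
    trace : Fin n → Subset ∣ C ∣
    trace v = restrict C (λ w → does (InN? v w))

    index : Subset ∣ C ∣ → Fin (size (all ∣ C ∣))
    index S = encode (all ∣ C ∣) S tt

    trace-injective : ∀ {u v} → index (trace u) ≡ index (trace v) → u ≡ v
    trace-injective {u} {v} eq = decidable-stable (u ≟ v) λ u≢v → separates u v u≢v same-trace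
      where
      same : ∀ {w} → w ∈ C → does (InN? u w) ≡ does (InN? v w)
      same = restrict-injective C (encode-injective (all ∣ C ∣) eq)
      same-trace : ∀ w → (InI G C u w → InI G C v w) × (InI G C v w → InI G C u w)
      same-trace w = (λ (w∈C , u~w) → w∈C , does-transfer (InN? u w) (InN? v w) (same w∈C) u~w)
                   , (λ (w∈C , v~w) → w∈C , does-transfer (InN? v w) (InN? u w) (sym (same w∈C)) v~w)

  separating-by-labels : ∀ {k} (C : Subset n) (code : Fin k → Fin n) (label : Fin n → Subset k) →
                         (∀ j → code j ∈ C) → (∀ v j → InN G v (code j) ⇔ j ∈ label v) →
                         Injective _≡_ _≡_ label → ∀ u v → u ≢ v → Separates G C u v
  separating-by-labels C code label code∈C N⇔label label-injective u v u≢v same =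
    u≢v (label-injective (⊆-antisym (label-⊆ (proj₁ ∘ same)) (label-⊆ (proj₂ ∘ same))))
    where
    label-⊆ : ∀ {x y} → (∀ w → InI G C x w → InI G C y w) → label x ⊆ label y
    label-⊆ {x} {y} x⇒y {j} j∈x =
      to (N⇔label y j) (proj₂ (x⇒y (code j) (code∈C j , from (N⇔label x j) j∈x)))

  pinned∈self-identifying : ∀ {C} → IsSelfIdCode G C → ∀ {x} → Pinned (InN G) x → x ∈ C
  pinned∈self-identifying {C} code (u , v , u≢v , only-x) with code u v u≢v
  ... | w , (w∈C , u~w) , ¬v~w = subst (_∈ C) (only-x w (u~w , λ v~w → ¬v~w (w∈C , v~w))) w∈C

  all-pinned⇒self-identifying-size : (∀ x → Pinned (InN G) x) → ∀ C → IsSelfIdCode G C → ∣ C ∣ ≡ n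
  all-pinned⇒self-identifying-size pinned C code =
    trans (cong ∣_∣ (⊆-antisym ⊆⊤ (λ {x} _ → pinned∈self-identifying code (pinned x)))) (∣⊤∣≡n n)

  ⊤-self-identifying : (∀ u v → u ≢ v → ∃ (Private (InN G) u v)) → IsSelfIdCode G ⊤
  ⊤-self-identifying escape u v u≢v with escape u v u≢v
  ... | w , u~w , ¬v~w = w , (∈⊤ , u~w) , ¬v~w ∘ proj₂

code-size-bound : ∀ {n k c} → 3 ≤ k → n + 2 ≡ 2 ^ k → n ≤ 2 ^ c → k ≤ c
code-size-bound {n} {suc k} {c} (s≤s 2≤k) n+2≡2^k n≤2^c = ≮⇒≥ λ c<k →
  4≰2 (≤-trans (^-monoʳ-≤ 2 2≤k) (+-cancelˡ-≤ (2 ^ k) _ _ (begin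
    2 ^ k + 2 ^ k ≡⟨ cong (2 ^ k +_) (+-identityʳ (2 ^ k)) ⟨
    2 ^ suc k     ≡⟨ n+2≡2^k ⟨
    n + 2         ≤⟨ +-monoˡ-≤ 2 (≤-trans n≤2^c (^-monoʳ-≤ 2 (s≤s⁻¹ c<k))) ⟩
    2 ^ k + 2     ∎)))
  where
  open ≤-Reasoning
  4≰2 : ¬ 4 ≤ 2
  4≰2 (s≤s (s≤s ()))

Closed : ∀ {V : Set} → (V → V → Set) → V → V → Set
Closed R a b = b ≡ a ⊎ R a b

module Relabelled {k m : ℕ} (R : Fin k ⊎ Fin m → Fin k ⊎ Fin m → Set)
                  (R-sym : ∀ {a b} → R a b → R b a) (R-irrefl : ∀ {a} → ¬ R a a) where

  vertex : Fin (k + m) → Fin k ⊎ Fin m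
  vertex = splitAt k

  index : Fin k ⊎ Fin m → Fin (k + m)
  index = join k m

  graph : Graph
  graph = record { n = k + m ; Adj = λ x y → R (vertex x) (vertex y) ; sym = R-sym ; irrefl = R-irrefl }

  InN⇔Closed : ∀ {x y} → InN graph x y ⇔ Closed R (vertex x) (vertex y)
  InN⇔Closed = mk⇔ (Sum.map₁ (cong vertex)) (Sum.map₁ (splitAt-injective k))

  InN-index⇔ : ∀ {a y} → InN graph (index a) y ⇔ Closed R a (vertex y)
  InN-index⇔ {a} {y} = mk⇔
    (subst (λ c → Closed R c (vertex y)) (splitAt-join k m a) ∘ to InN⇔Closed)
    (from InN⇔Closed ∘ subst (λ c → Closed R c (vertex y)) (sym (splitAt-join k m a)))

  InN-index⇔′ : ∀ {x b} → InN graph x (index b) ⇔ Closed R (vertex x) b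
  InN-index⇔′ {x} {b} = mk⇔
    (subst (Closed R (vertex x)) (splitAt-join k m b) ∘ to InN⇔Closed)
    (from InN⇔Closed ∘ subst (Closed R (vertex x)) (sym (splitAt-join k m b)))

  InN? : (∀ a b → Dec (R a b)) → ∀ x y → Dec (InN graph x y)
  InN? R? x y = y ≟ x ⊎-dec R? (vertex x) (vertex y)

  connected : (∀ a b → Star R a b) → Connected graph
  connected walk x y = subst₂ (Star (Graph.Adj graph)) (join-splitAt k m x) (join-splitAt k m y)
    (gmap index (λ {a} {b} → subst₂ R (sym (splitAt-join k m a)) (sym (splitAt-join k m b)))
          (walk (vertex x) (vertex y)))

  InN-pinned : ∀ {x} → Pinned (Closed R) (vertex x) → Pinned (InN graph) x
  InN-pinned {x} (u , v , u≢v , only) = index u , index v , u≢v ∘ index-injective , only′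
    where
    index-injective : index u ≡ index v → u ≡ v
    index-injective eq = trans (sym (splitAt-join k m u)) (trans (cong vertex eq) (splitAt-join k m v))
    only′ : ∀ w → Private (InN graph) (index u) (index v) w → w ≡ x
    only′ w (u~w , ¬v~w) =
      splitAt-injective k (only (vertex w) (to InN-index⇔ u~w , ¬v~w ∘ from InN-index⇔))

  InN-private : ∀ {x y} → ∃ (Private (Closed R) (vertex x) (vertex y)) → ∃ (Private (InN graph) x y)
  InN-private (w , x~w , ¬y~w) = index w , from InN-index⇔′ x~w , ¬y~w ∘ to InN-index⇔′

  codes : Subset (k + m)
  codes = ⊤ {k} ++ ⊥ {m}

  code∈codes : ∀ i → index (inj₁ i) ∈ codes
  code∈codes i =
    lookup⇒[]= (i ↑ˡ m) codes (trans (lookup-++ˡ (⊤ {k}) (⊥ {m}) i) (lookup-replicate i inside))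

  ∣codes∣ : ∣ codes ∣ ≡ k
  ∣codes∣ = count k
    where
    count : ∀ j → ∣ ⊤ {j} ++ ⊥ {m} ∣ ≡ j
    count zero    = ∣⊥∣≡0 m
    count (suc j) = cong suc (count j)

  codes-total-dominating-identifying : (label : Fin k ⊎ Fin m → Subset k) →
    (∀ a j → Closed R a (inj₁ j) ⇔ j ∈ label a) → Injective _≡_ _≡_ label →
    (∀ a → ∃ λ j → R a (inj₁ j)) → IsTotalDomIdCode graph codes
  codes-total-dominating-identifying label Closed⇔label label-injective code-neighbour =
    separating-by-labels graph codes (index ∘ inj₁) (label ∘ vertex) code∈codes
      (λ v j → Closed⇔label (vertex v) j ⇔-∘ InN-index⇔′)
      (splitAt-injective k ∘ label-injective)
    , λ v → let j , r = code-neighbour (vertex v) in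
            index (inj₁ j) , code∈codes j , subst (R (vertex v)) (sym (splitAt-join k m (inj₁ j))) r

module _ {k : ℕ} where

  Covering : Subset k → Subset k → Set
  Covering S T = ∀ x → x ∈ S ⊎ x ∈ T

  covering-∁ : ∀ (S : Subset k) → Covering S (∁ S)
  covering-∁ S x with x ∈? S
  ... | yes x∈S = inj₁ x∈S
  ... | no x∉S  = inj₂ (x∉p⇒x∈∁p x∉S)

  ⁅⁆-injective : ∀ {i j : Fin k} → ⁅ i ⁆ ≡ ⁅ j ⁆ → i ≡ j
  ⁅⁆-injective {i} {j} eq = x∈⁅y⁆⇒x≡y j (subst (i ∈_) eq (x∈⁅x⁆ i))

  ∈∁⁅⁆⇔≢ : ∀ {x a : Fin k} → x ∈ ∁ ⁅ a ⁆ ⇔ x ≢ a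
  ∈∁⁅⁆⇔≢ = mk⇔ (x∉⁅y⁆⇒x≢y ∘ x∈∁p⇒x∉p) (x∉p⇒x∈∁p ∘ x≢y⇒x∉⁅y⁆)

  ∉∪⁅⁆ : ∀ {S : Subset k} {a x} → x ∉ S → x ≢ a → x ∉ S ∪ ⁅ a ⁆
  ∉∪⁅⁆ {S} {a} x∉S x≢a = [ x∉S , x≢a ∘ x∈⁅y⁆⇒x≡y a ]′ ∘ x∈p∪q⁻ S ⁅ a ⁆

  one-outside⇒¬TwoOutside : ∀ {S : Subset k} {a} → (∀ x → x ∉ S → x ≡ a) → ¬ TwoOutside S
  one-outside⇒¬TwoOutside only-a (x , y , x≢y , x∉ , y∉) = x≢y (trans (only-a x x∉) (sym (only-a y y∉)))

  ¬TwoOutside-∁⁅⁆ : ∀ {a} → ¬ TwoOutside (∁ ⁅ a ⁆)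
  ¬TwoOutside-∁⁅⁆ {a} = one-outside⇒¬TwoOutside λ x x∉ → x∈⁅y⁆⇒x≡y a (x∉∁p⇒x∈p x∉)

  ¬Covering-⁅⁆ : ∀ {j} {T : Subset k} → Covering ⁅ j ⁆ T → ¬ TwoOutside T
  ¬Covering-⁅⁆ {j} cover = one-outside⇒¬TwoOutside λ x x∉T →
    [ x∈⁅y⁆⇒x≡y j , (λ x∈T → contradiction x∈T x∉T) ]′ (cover x)

  medium-∁ : ∀ {S : Subset k} {x y z} → x ∉ S → y ∈ S → z ∈ S → y ≢ z → Medium (∁ S)
  medium-∁ x∉S y∈S z∈S y≢z =
    (_ , x∉p⇒x∈∁p x∉S) , _ , _ , y≢z , (λ y∈ → x∈∁p⇒x∉p y∈ y∈S) , (λ z∈ → x∈∁p⇒x∉p z∈ z∈S)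

  medium-∪⁅⁆ : ∀ {S : Subset k} {a b c} → b ∉ S → c ∉ S → b ≢ c → b ≢ a → c ≢ a → Medium (S ∪ ⁅ a ⁆)
  medium-∪⁅⁆ {a = a} b∉S c∉S b≢c b≢a c≢a =
    (a , x∈p∪q⁺ (inj₂ (x∈⁅x⁆ a))) , _ , _ , b≢c , ∉∪⁅⁆ b∉S b≢a , ∉∪⁅⁆ c∉S c≢a

  ⁅⁆-or-another : ∀ {S : Subset k} {i} → i ∈ S → S ≡ ⁅ i ⁆ ⊎ ∃ λ l → l ∈ S × l ≢ i
  ⁅⁆-or-another {S} {i} i∈S with any? (λ l → l ∈? S ×-dec ¬? (l ≟ i))
  ... | yes another = inj₂ another
  ... | no ¬another = inj₁ (⊆-antisym S⊆⁅i⁆ ⁅i⁆⊆S)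
    where
    S⊆⁅i⁆ : S ⊆ ⁅ i ⁆
    S⊆⁅i⁆ {l} l∈S with l ≟ i
    ... | yes refl = x∈⁅x⁆ i
    ... | no l≢i   = contradiction (l , l∈S , l≢i) ¬another
    ⁅i⁆⊆S : ⁅ i ⁆ ⊆ S
    ⁅i⁆⊆S {l} l∈ = subst (_∈ S) (sym (x∈⁅y⁆⇒x≡y i l∈)) i∈S

  third-outside-or-only-two : ∀ (S : Subset k) a b →
    (∃ λ c → c ∉ S × c ≢ a × c ≢ b) ⊎ (∀ x → x ∉ S → x ≡ a ⊎ x ≡ b)
  third-outside-or-only-two S a b with any? (λ c → ¬? (c ∈? S) ×-dec ¬? (c ≟ a) ×-dec ¬? (c ≟ b))
  ... | yes third = inj₁ third
  ... | no ¬third = inj₂ only-two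
    where
    only-two : ∀ x → x ∉ S → x ≡ a ⊎ x ≡ b
    only-two x x∉S with x ≟ a | x ≟ b
    ... | yes x≡a | _       = inj₁ x≡a
    ... | no _    | yes x≡b = inj₂ x≡b
    ... | no x≢a  | no x≢b  = contradiction (x , x∉S , x≢a , x≢b) ¬third

  ∈-by-exclusion : ∀ {S : Subset k} {a b x} → (∀ y → y ∉ S → y ≡ a ⊎ y ≡ b) → x ≢ a → x ≢ b → x ∈ S
  ∈-by-exclusion {S} {x = x} only-ab x≢a x≢b with x ∈? S
  ... | yes x∈S = x∈S
  ... | no x∉S  = contradiction (only-ab x x∉S) [ x≢a , x≢b ]′

  ⊆-TwoOutside⇒≡ : ∀ {S T : Subset k} {a b} → (∀ x → x ∉ S → x ≡ a ⊎ x ≡ b) →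
                   S ⊆ T → a ∉ T → TwoOutside T → T ≡ S
  ⊆-TwoOutside⇒≡ {S} {T} {a} {b} only-ab S⊆T a∉T two = ⊆-antisym T⊆S S⊆T
    where
    outside-T : ∀ z → z ∉ T → z ≡ a ⊎ z ≡ b
    outside-T z z∉T = only-ab z (z∉T ∘ S⊆T)
    b∉ : TwoOutside T → b ∉ T
    b∉ (x , y , x≢y , x∉T , y∉T) with outside-T x x∉T | outside-T y y∉T
    ... | inj₂ refl | _         = x∉T
    ... | _         | inj₂ refl = y∉T
    ... | inj₁ refl | inj₁ refl = contradiction refl x≢y
    b∉T : b ∉ T
    b∉T = b∉ two
    T⊆S : T ⊆ S
    T⊆S {z} z∈T = ∈-by-exclusion only-ab (λ { refl → a∉T z∈T }) (λ { refl → b∉T z∈T })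

module PairedCodeGraph {k : ℕ} (p : Fin k → Fin k) (p-involutive : ∀ i → p (p i) ≡ i)
                       (p-≢ : ∀ i → p i ≢ i) (another-pair : ∀ i → ∃ λ j → j ≢ i × j ≢ p i) where

  M : ℕ
  M = size (medium k)

  set : Fin M → Subset k
  set = decode (medium k)

  set-medium : ∀ t → Medium (set t)
  set-medium = decode-sound (medium k)

  set-injective : Injective _≡_ _≡_ set
  set-injective = decode-injective (medium k)

  vertexOf : (S : Subset k) → Medium S → Fin M
  vertexOf = encode (medium k)

  ∈-vertexOf : ∀ {S m x} → x ∈ set (vertexOf S m) ⇔ x ∈ S
  ∈-vertexOf {S} {m} = mk⇔ (subst (_ ∈_) (decode-encode (medium k) S m))
                           (subst (_ ∈_) (sym (decode-encode (medium k) S m)))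

  p-injective : Injective _≡_ _≡_ p
  p-injective {i} {j} eq = trans (sym (p-involutive i)) (trans (cong p eq) (p-involutive j))

  p-flip : ∀ {i j} → i ≡ p j → p i ≡ j
  p-flip {j = j} eq = trans (cong p eq) (p-involutive j)

  medium-⁅⁆ : ∀ i → Medium ⁅ i ⁆
  medium-⁅⁆ i = let j , j≢i , j≢pi = another-pair i in
    (i , x∈⁅x⁆ i) , p i , j , j≢pi ∘ sym , x≢y⇒x∉⁅y⁆ (p-≢ i) , x≢y⇒x∉⁅y⁆ j≢i

  single : Fin k → Fin M
  single i = vertexOf ⁅ i ⁆ (medium-⁅⁆ i)

  set-single : ∀ i → set (single i) ≡ ⁅ i ⁆
  set-single i = decode-encode (medium k) ⁅ i ⁆ (medium-⁅⁆ i)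

  ∈single⇔≡ : ∀ {i j} → j ∈ set (single i) ⇔ j ≡ i
  ∈single⇔≡ {i} = mk⇔ (x∈⁅y⁆⇒x≡y i ∘ to ∈-vertexOf) (λ { refl → from ∈-vertexOf (x∈⁅x⁆ i) })

  set≡⁅⁆⇒≡single : ∀ {r i} → set r ≡ ⁅ i ⁆ → r ≡ single i
  set≡⁅⁆⇒≡single {i = i} eq = set-injective (trans eq (sym (set-single i)))

  _≟ˢ_ : (S T : Subset k) → Dec (S ≡ T)
  _≟ˢ_ = ≡-dec Bool._≟_

  V : Set
  V = Fin k ⊎ Fin M

  pattern code i = inj₁ i
  pattern mid t  = inj₂ t

  Adj : V → V → Set
  Adj (code i) (code j) = j ≢ i × j ≢ p i
  Adj (code i) (mid t)  = i ∈ set t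
  Adj (mid t)  (code i) = i ∈ set t
  Adj (mid s)  (mid t)  = Covering (set s) (set t) ⊎ ∃ λ j → set s ≡ ⁅ j ⁆ × set t ≡ ⁅ p j ⁆

  N : V → V → Set
  N = Closed Adj

  Adj-sym : ∀ {a b} → Adj a b → Adj b a
  Adj-sym {code i} {code j} (j≢i , j≢pi) = j≢i ∘ sym , λ i≡pj → j≢pi (sym (p-flip i≡pj))
  Adj-sym {code i} {mid t}  i∈t = i∈t
  Adj-sym {mid t}  {code i} i∈t = i∈t
  Adj-sym {mid s}  {mid t}  (inj₁ cover) = inj₁ (Sum.swap ∘ cover)
  Adj-sym {mid s}  {mid t}  (inj₂ (j , s≡ , t≡)) =
    inj₂ (p j , t≡ , trans s≡ (cong ⁅_⁆ (sym (p-involutive j))))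

  Adj-irrefl : ∀ {a} → ¬ Adj a a
  Adj-irrefl {code i} (i≢i , _) = i≢i refl
  Adj-irrefl {mid t}  (inj₁ cover) with set-medium t
  ... | _ , x , _ , _ , x∉ , _ = [ x∉ , x∉ ]′ (cover x)
  Adj-irrefl {mid t}  (inj₂ (j , t≡ , t≡′)) = p-≢ j (sym (⁅⁆-injective (trans (sym t≡) t≡′)))

  Adj? : ∀ a b → Dec (Adj a b)
  Adj? (code i) (code j) = ¬? (j ≟ i) ×-dec ¬? (j ≟ p i)
  Adj? (code i) (mid t)  = i ∈? set t
  Adj? (mid t)  (code i) = i ∈? set t
  Adj? (mid s)  (mid t)  = all? (λ x → x ∈? set s ⊎-dec x ∈? set t)
                           ⊎-dec any? (λ j → set s ≟ˢ ⁅ j ⁆ ×-dec set t ≟ˢ ⁅ p j ⁆)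

  N? : ∀ a b → Dec (N a b)
  N? a b = ⊎-≡-dec _≟_ _≟_ b a ⊎-dec Adj? a b

  label : V → Subset k
  label (code i) = ∁ ⁅ p i ⁆
  label (mid t)  = set t

  N-code⇔label : ∀ a j → N a (code j) ⇔ j ∈ label a
  N-code⇔label (code i) j = mk⇔ N⇒∈ ∈⇒N
    where
    N⇒∈ : N (code i) (code j) → j ∈ ∁ ⁅ p i ⁆
    N⇒∈ (inj₁ refl)       = from ∈∁⁅⁆⇔≢ (p-≢ i ∘ sym)
    N⇒∈ (inj₂ (_ , j≢pi)) = from ∈∁⁅⁆⇔≢ j≢pi
    ∈⇒N : j ∈ ∁ ⁅ p i ⁆ → N (code i) (code j)
    ∈⇒N j∈ with j ≟ i
    ... | yes refl = inj₁ refl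
    ... | no j≢i   = inj₂ (j≢i , to ∈∁⁅⁆⇔≢ j∈)
  N-code⇔label (mid t) j = mk⇔ (λ { (inj₁ ()) ; (inj₂ j∈t) → j∈t }) inj₂

  label-injective : Injective _≡_ _≡_ label
  label-injective {code i} {code i′} eq = cong code (p-injective (decidable-stable (p i ≟ p i′) λ pi≢pi′ →
    to ∈∁⁅⁆⇔≢ (subst (p i ∈_) (sym eq) (from ∈∁⁅⁆⇔≢ pi≢pi′)) refl))
  label-injective {code i} {mid t}  eq =
    contradiction (subst TwoOutside (sym eq) (proj₂ (set-medium t))) ¬TwoOutside-∁⁅⁆
  label-injective {mid t}  {code i} eq =
    contradiction (subst TwoOutside eq (proj₂ (set-medium t))) ¬TwoOutside-∁⁅⁆
  label-injective {mid s}  {mid t}  eq = cong mid (set-injective eq)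

  code-neighbour : ∀ a → ∃ λ j → Adj a (code j)
  code-neighbour (code i) = another-pair i
  code-neighbour (mid t)  = proj₁ (set-medium t)

  walk-to-code : ∀ a z → Star Adj a (code z)
  walk-to-code (code i) z with i ≟ z | i ≟ p z
  ... | yes refl | _        = ε
  ... | no i≢z   | no i≢pz  = (i≢z ∘ sym , i≢pz ∘ sym ∘ p-flip) ◅ ε
  ... | no _     | yes refl = let o , o≢z , o≢pz = another-pair z in
    (o≢pz , subst (o ≢_) (sym (p-involutive z)) o≢z) ◅ Adj-sym (o≢z , o≢pz) ◅ ε
  walk-to-code (mid t) z = let l , l∈t = proj₁ (set-medium t) in l∈t ◅ walk-to-code (code l) z

  walk : ∀ a b → Star Adj a b
  walk a (code z) = walk-to-code a z
  walk a (mid t)  = let l , l∈t = proj₁ (set-medium t) in walk-to-code a l ◅◅ (l∈t ◅ ε)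

  private-code : ∀ {a b l} → l ∈ label a → l ∉ label b → Private N a b (code l)
  private-code {a} {b} {l} l∈a l∉b = from (N-code⇔label a l) l∈a , l∉b ∘ to (N-code⇔label b l)

  ¬Covering-single : ∀ {i} r → ¬ Covering (set (single i)) (set r)
  ¬Covering-single {i} r cover =
    ¬Covering-⁅⁆ (subst (λ S → Covering S (set r)) (set-single i) cover) (proj₂ (set-medium r))

  private-of-adjacent : ∀ a b → Adj b a → ∃ (Private N a b)
  private-of-adjacent (code i) (code j) (i≢j , _) =
    mid (single i) , inj₂ (from ∈single⇔≡ refl) , λ { (inj₁ ()) ; (inj₂ j∈) → i≢j (sym (to ∈single⇔≡ j∈)) }
  private-of-adjacent (code i) (mid t) i∈t with set t ≟ˢ ⁅ i ⁆
  ... | yes t≡⁅i⁆ = let o , o≢i , o≢pi = another-pair i in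
    code o , private-code (from ∈∁⁅⁆⇔≢ o≢pi) (o≢i ∘ x∈⁅y⁆⇒x≡y i ∘ subst (o ∈_) t≡⁅i⁆)
  ... | no t≢⁅i⁆ = mid (single i) , inj₂ (from ∈single⇔≡ refl) , ¬t~single
    where
    ¬t~single : ¬ N (mid t) (mid (single i))
    ¬t~single (inj₁ single≡t) = t≢⁅i⁆ (trans (cong set (sym (inj₂-injective single≡t))) (set-single i))
    ¬t~single (inj₂ (inj₁ cover)) = ¬Covering-single t (Sum.swap ∘ cover)
    ¬t~single (inj₂ (inj₂ (j , t≡⁅j⁆ , _))) =
      t≢⁅i⁆ (trans t≡⁅j⁆ (cong ⁅_⁆ (sym (x∈⁅y⁆⇒x≡y j (subst (i ∈_) t≡⁅j⁆ i∈t)))))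
  private-of-adjacent (mid s) (code i) i∈s with ⁅⁆-or-another i∈s
  ... | inj₁ s≡⁅i⁆ =
    mid (single (p i)) , inj₂ (inj₂ (i , s≡⁅i⁆ , set-single (p i))) ,
    λ { (inj₁ ()) ; (inj₂ i∈) → p-≢ i (sym (to ∈single⇔≡ i∈)) }
  ... | inj₂ (l , l∈s , l≢i) =
    mid complement , inj₂ (inj₁ λ x → Sum.map₂ (from ∈-vertexOf) (covering-∁ (set s) x)) ,
    λ { (inj₁ ()) ; (inj₂ i∈) → x∈∁p⇒x∉p (to ∈-vertexOf i∈) i∈s }
    where
    complement : Fin M
    complement = let _ , _ , _ , _ , a∉s , _ = set-medium s in
      vertexOf (∁ (set s)) (medium-∁ a∉s i∈s l∈s (l≢i ∘ sym))
  private-of-adjacent (mid s) (mid t) (inj₁ cover) = let _ , a , _ , _ , a∉t , _ = set-medium t in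
    code a , private-code ([ (λ a∈t → contradiction a∈t a∉t) , (λ a∈s → a∈s) ]′ (cover a)) a∉t
  private-of-adjacent (mid s) (mid t) (inj₂ (j , t≡⁅j⁆ , s≡⁅pj⁆)) =
    code (p j) , private-code (subst (p j ∈_) (sym s≡⁅pj⁆) (x∈⁅x⁆ (p j)))
                              (p-≢ j ∘ x∈⁅y⁆⇒x≡y j ∘ subst (p j ∈_) t≡⁅j⁆)

  private-neighbour : ∀ a b → a ≢ b → ∃ (Private N a b)
  private-neighbour a b a≢b with N? b a
  ... | no ¬b~a        = a , inj₁ refl , ¬b~a
  ... | yes (inj₁ a≡b) = contradiction a≡b a≢b
  ... | yes (inj₂ b-a) = private-of-adjacent a b b-a

  pinned-code : ∀ j → Pinned N (code j)
  pinned-code j = mid (single j) , mid (single (p j)) , singles-distinct , only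
    where
    singles-distinct : mid (single j) ≢ mid (single (p j))
    singles-distinct eq = p-≢ j (sym (⁅⁆-injective
      (trans (sym (set-single j)) (trans (cong set (inj₂-injective eq)) (set-single (p j))))))
    only : ∀ w → Private N (mid (single j)) (mid (single (p j))) w → w ≡ code j
    only _ (inj₁ refl , ¬v~u) = contradiction
      (inj₂ (inj₂ (p j , set-single (p j) , trans (set-single j) (cong ⁅_⁆ (sym (p-involutive j)))))) ¬v~u
    only (code l) (inj₂ l∈ , _) = cong code (to ∈single⇔≡ l∈)
    only (mid r)  (inj₂ (inj₁ cover) , _) = contradiction cover (¬Covering-single r)
    only (mid r)  (inj₂ (inj₂ (j′ , j≡ , r≡)) , ¬v~w) =
      contradiction (inj₁ (cong mid (set≡⁅⁆⇒≡single r≡⁅pj⁆))) ¬v~w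
      where
      r≡⁅pj⁆ : set r ≡ ⁅ p j ⁆
      r≡⁅pj⁆ = trans r≡ (cong (⁅_⁆ ∘ p) (sym (⁅⁆-injective (trans (sym (set-single j)) j≡))))

  pinned-singleton : ∀ {s j} → set s ≡ ⁅ j ⁆ → Pinned N (mid s)
  pinned-singleton {s} {j} s≡⁅j⁆ = mid (single (p j)) , code (p j) , (λ ()) , only
    where
    only : ∀ w → Private N (mid (single (p j))) (code (p j)) w → w ≡ mid s
    only _ (inj₁ refl , ¬v~u) = contradiction (inj₂ (from ∈single⇔≡ refl)) ¬v~u
    only (code l) (inj₂ l∈ , ¬v~w) = contradiction (inj₁ (cong code (to ∈single⇔≡ l∈))) ¬v~w
    only (mid r)  (inj₂ (inj₁ cover) , _) = contradiction cover (¬Covering-single r)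
    only (mid r)  (inj₂ (inj₂ (j′ , pj≡ , r≡)) , _) = cong mid (set-injective (begin
      set r       ≡⟨ r≡ ⟩
      ⁅ p j′ ⁆    ≡⟨ cong (⁅_⁆ ∘ p) (⁅⁆-injective (trans (sym pj≡) (set-single (p j)))) ⟩
      ⁅ p (p j) ⁆ ≡⟨ cong ⁅_⁆ (p-involutive j) ⟩
      ⁅ j ⁆       ≡⟨ s≡⁅j⁆ ⟨
      set s       ∎))
      where open ≡-Reasoning

  pinned-by-domination : ∀ {s} v → mid s ≢ v → (∀ j → set s ≢ ⁅ j ⁆) →
    (∀ l → l ∈ set s → N v (code l)) → (∀ r → Covering (set s) (set r) → N v (mid r)) → Pinned N (mid s)
  pinned-by-domination {s} v s≢v not-singleton codes-dominated mids-dominated = mid s , v , s≢v , only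
    where
    only : ∀ w → Private N (mid s) v w → w ≡ mid s
    only _ (inj₁ refl , _) = refl
    only (code l) (inj₂ l∈s , ¬v~w) = contradiction (codes-dominated l l∈s) ¬v~w
    only (mid r)  (inj₂ (inj₁ cover) , ¬v~w) = contradiction (mids-dominated r cover) ¬v~w
    only (mid r)  (inj₂ (inj₂ (j , s≡⁅j⁆ , _)) , _) = contradiction s≡⁅j⁆ (not-singleton j)

  pinned-superset : ∀ {s t} → (∀ j → set s ≢ ⁅ j ⁆) → s ≢ t → set s ⊆ set t → Pinned N (mid s)
  pinned-superset {s} {t} not-singleton s≢t s⊆t =
    pinned-by-domination (mid t) (s≢t ∘ inj₂-injective) not-singleton
      (λ l l∈s → inj₂ (s⊆t l∈s))
      (λ r cover → inj₂ (inj₁ (Sum.map₁ s⊆t ∘ cover)))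

  pinned-pair : ∀ {s a} → (∀ j → set s ≢ ⁅ j ⁆) → a ∉ set s → p a ∉ set s → Pinned N (mid s)
  pinned-pair {s} {a} not-singleton a∉s pa∉s =
    pinned-by-domination (code a) (λ ()) not-singleton
      (λ l l∈s → inj₂ ((λ { refl → a∉s l∈s }) , (λ { refl → pa∉s l∈s })))
      (λ r cover → inj₂ ([ (λ a∈s → contradiction a∈s a∉s) , (λ a∈r → a∈r) ]′ (cover a)))

  -- ∁ S = {a, b}; its neighbours outside N[code a] are subset vertices covering with it, so
  -- containing S, and missing a: only S itself.
  pinned-complement : ∀ {s a b} → a ≢ b → b ≢ p a → a ∉ set s → b ∉ set s →
                      (∀ x → x ∉ set s → x ≡ a ⊎ x ≡ b) → Pinned N (mid s)
  pinned-complement {s} {a} {b} a≢b b≢pa a∉s b∉s only-ab = mid c , code a , (λ ()) , only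
    where
    pa∈s : p a ∈ set s
    pa∈s = ∈-by-exclusion only-ab (p-≢ a) (b≢pa ∘ sym)
    pb∈s : p b ∈ set s
    pb∈s = ∈-by-exclusion only-ab (λ pb≡a → b≢pa (trans (sym (p-involutive b)) (cong p pb≡a))) (p-≢ b)
    c : Fin M
    c = vertexOf (∁ (set s)) (medium-∁ a∉s pa∈s pb∈s (a≢b ∘ p-injective))
    ∈c : ∀ {x} → x ∉ set s → x ∈ set c
    ∈c = from ∈-vertexOf ∘ x∉p⇒x∈∁p
    ∉s : ∀ {x} → x ∈ set c → x ∉ set s
    ∉s = x∈∁p⇒x∉p ∘ to ∈-vertexOf
    only : ∀ w → Private N (mid c) (code a) w → w ≡ mid s
    only _ (inj₁ refl , ¬v~u) = contradiction (inj₂ (∈c a∉s)) ¬v~u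
    only (code l) (inj₂ l∈c , ¬v~w) with only-ab l (∉s l∈c)
    ... | inj₁ refl = contradiction (inj₁ refl) ¬v~w
    ... | inj₂ refl = contradiction (inj₂ (a≢b ∘ sym , b≢pa)) ¬v~w
    only (mid r) (inj₂ (inj₁ cover) , ¬v~w) with a ∈? set r
    ... | yes a∈r = contradiction (inj₂ a∈r) ¬v~w
    ... | no a∉r  = cong mid (set-injective (⊆-TwoOutside⇒≡ only-ab s⊆r a∉r (proj₂ (set-medium r))))
      where
      s⊆r : set s ⊆ set r
      s⊆r {l} l∈s = [ (λ l∈c → contradiction l∈s (∉s l∈c)) , (λ l∈r → l∈r) ]′ (cover l)
    only (mid r) (inj₂ (inj₂ (j , c≡⁅j⁆ , _)) , _) =
      contradiction (trans (≡j (∈c a∉s)) (sym (≡j (∈c b∉s)))) a≢b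
      where
      ≡j : ∀ {x} → x ∈ set c → x ≡ j
      ≡j = x∈⁅y⁆⇒x≡y j ∘ subst (_ ∈_) c≡⁅j⁆

  pinned-non-singleton : ∀ s → (∀ j → set s ≢ ⁅ j ⁆) → Pinned N (mid s)
  pinned-non-singleton s not-singleton with proj₂ (set-medium s)
  ... | a , b , a≢b , a∉s , b∉s with third-outside-or-only-two (set s) a b
  ...   | inj₁ (c , c∉s , c≢a , c≢b) = pinned-superset not-singleton s≢t s⊆t
    where
    t : Fin M
    t = vertexOf (set s ∪ ⁅ a ⁆) (medium-∪⁅⁆ b∉s c∉s (c≢b ∘ sym) (a≢b ∘ sym) c≢a)
    s⊆t : set s ⊆ set t
    s⊆t = from ∈-vertexOf ∘ x∈p∪q⁺ ∘ inj₁
    s≢t : s ≢ t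
    s≢t s≡t = a∉s (subst (λ u → a ∈ set u) (sym s≡t) (from ∈-vertexOf (x∈p∪q⁺ (inj₂ (x∈⁅x⁆ a)))))
  ...   | inj₂ only-ab with b ≟ p a
  ...     | yes refl = pinned-pair not-singleton a∉s b∉s
  ...     | no b≢pa  = pinned-complement a≢b b≢pa a∉s b∉s only-ab

  pinned : ∀ x → Pinned N x
  pinned (code j) = pinned-code j
  pinned (mid s) with any? (λ j → set s ≟ˢ ⁅ j ⁆)
  ... | yes (j , s≡⁅j⁆) = pinned-singleton s≡⁅j⁆
  ... | no ¬singleton   = pinned-non-singleton s (λ j s≡⁅j⁆ → ¬singleton (j , s≡⁅j⁆))

  open Relabelled Adj Adj-sym Adj-irrefl

  vertex-count : 3 ≤ k → k + M + 2 ≡ 2 ^ k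
  vertex-count (s≤s 2≤k) = size-medium k (≤-trans 2≤k (n≤1+n _))

  paired-code-graph : 3 ≤ k → ∃ λ (G : Graph) → Connected G × γtID≡ G k × γSID≡ G (2 ^ k ∸ 2)
  paired-code-graph 3≤k = graph , connected walk , γtID , γSID
    where
    n≡ : k + M ≡ 2 ^ k ∸ 2
    n≡ = trans (sym (m+n∸n≡m (k + M) 2)) (cong (_∸ 2) (vertex-count 3≤k))

    codes-TD-ID : IsTotalDomIdCode graph codes
    codes-TD-ID = codes-total-dominating-identifying label N-code⇔label label-injective code-neighbour

    γtID : γtID≡ graph k
    γtID = (codes , codes-TD-ID , ∣codes∣) , λ C C-TD-ID →
      code-size-bound 3≤k (vertex-count 3≤k) (separating-code-size graph (InN? Adj?) C (proj₁ C-TD-ID))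

    ⊤-self-ID : IsSelfIdCode graph ⊤
    ⊤-self-ID = ⊤-self-identifying graph λ x y x≢y →
      InN-private (private-neighbour (vertex x) (vertex y) (x≢y ∘ splitAt-injective k))

    γSID : γSID≡ graph (2 ^ k ∸ 2)
    γSID = (⊤ , ⊤-self-ID , trans (∣⊤∣≡n (k + M)) n≡) , λ C C-self-ID →
      ≤-reflexive (trans (sym n≡) (sym (all-pinned⇒self-identifying-size graph every-vertex-pinned C C-self-ID)))
      where
      every-vertex-pinned : ∀ x → Pinned (InN graph) x
      every-vertex-pinned = InN-pinned ∘ pinned ∘ vertex

partner : ∀ q → Fin (q * 2) → Fin (q * 2)
partner (suc q) zero          = suc zero
partner (suc q) (suc zero)    = zero
partner (suc q) (suc (suc i)) = suc (suc (partner q i))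

partner-involutive : ∀ q i → partner q (partner q i) ≡ i
partner-involutive (suc q) zero          = refl
partner-involutive (suc q) (suc zero)    = refl
partner-involutive (suc q) (suc (suc i)) = cong (λ j → suc (suc j)) (partner-involutive q i)

partner-≢ : ∀ q i → partner q i ≢ i
partner-≢ (suc q) (suc (suc i)) eq = partner-≢ q i (suc-injective (suc-injective eq))

another-pair : ∀ q (i : Fin ((2 + q) * 2)) → ∃ λ j → j ≢ i × j ≢ partner (2 + q) i
another-pair q zero          = suc (suc zero) , (λ ()) , (λ ())
another-pair q (suc zero)    = suc (suc zero) , (λ ()) , (λ ())
another-pair q (suc (suc i)) = zero , (λ ()) , (λ ())

proposition22 : ∀ (k : ℕ) → 2 ∣ k → 4 ≤ k →
    ∃ λ (G : Graph) → Connected G × γtID≡ G k × γSID≡ G (2 ^ k ∸ 2)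
proposition22 .(0 * 2)       (divides zero refl)             ()
proposition22 .(1 * 2)       (divides (suc zero) refl)       (s≤s (s≤s ()))
proposition22 .((2 + q) * 2) (divides (suc (suc q)) refl) 4≤k =
  PairedCodeGraph.paired-code-graph (partner (2 + q)) (partner-involutive (2 + q)) (partner-≢ (2 + q))
    (another-pair q) (≤-trans (n≤1+n 3) 4≤k)
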